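{- Let $G$ be an undirected graph (loops allowed) that generates a fusion ring. If $G$ contains an induced path $i\sim j\sim k$ (i.e. $i,j,k$ distinct, $i\sim j$, $j\sim k$, $i\not\sim k$) such that the edge $\{i,j\}$ is not contained in any triangle of $G$, then both $i$ and $j$ have self-loops.
   Context: A fusion ring of rank $r$ (commutative) is a commutative unital ring, free as a $\mathbb{Z}$-module on a basis $X_0=1,X_1,\dots,X_{r-1}$, with $X_iX_j=\sum_k N_{ij}^kX_k$, $N_{ij}^k\in\mathbb{Z}_{\ge0}$, and an involution $i\mapsto i^*$ with $N_{ij}^0=\delta_{i,j^*}$ and $N_{ij}^k=N_{jk^*}^{i^*}=N_{j^*i^*}^{k^*}$. It is self-dual if $i^*=i$ for all $i$, multiplicity-free if all $N_{ij}^k\in\{0,1\}$. For such a ring the associated digraph $D$ on $\{1,\dots,r-1\}$ has a loop at $i$ iff $N_{ii}^i=1$ and, for $i\ne j$, an arc $(i,j)$ iff $N_{ii}^j=1$; the associated $3$-uniform hypergraph $H$ has hyperedge $\{i,j,k\}$ (distinct) iff $N_{ij}^k=1$. A digraph generates a fusion ring if it is the associated digraph of some self-dual multiplicity-free fusion ring. An undirected graph (possibly with loops) is identified with the digraph having arcs $(i,j),(j,i)$ for each edge $\{i,j\}$, $i\ne j$. A triangle is a set of three distinct pairwise adjacent vertices. -}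

module Defs where

open import Data.Nat using (ℕ; zero; suc; _+_; _*_; _≤_)
open import Data.Fin using (Fin; zero; suc)
open import Data.Bool using (Bool; true; false)
open import Data.Product using (_×_; ∃-syntax)
open import Relation.Binary.PropositionalEquality using (_≡_; _≢_)
open import Relation.Nullary using (¬_)
open import Function.Bundles using (_⇔_)

sumFin : (r : ℕ) → (Fin r → ℕ) → ℕ
sumFin zero    f = 0
sumFin (suc r) f = f zero + sumFin r (λ i → f (suc i))

δ : {r : ℕ} → Fin r → Fin r → ℕ
δ zero    zero    = 1
δ zero    (suc _) = 0
δ (suc _) zero    = 0
δ (suc i) (suc j) = δ i j

-- A commutative, self-dual (i* = i for all i), multiplicity-free fusion ring of
-- rank r = suc n, given by its structure constants  N i j k = N_{ij}^k  with
-- respect to the basis X_0 = 1, X_1, ..., X_n  (index zero is the unit X_0).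
record SDMFFusionRing (n : ℕ) : Set where
  field
    N      : Fin (suc n) → Fin (suc n) → Fin (suc n) → ℕ
    N-le1  : ∀ i j k → N i j k ≤ 1
    unitN  : ∀ j k → N zero j k ≡ δ j k
    comm   : ∀ i j k → N i j k ≡ N j i k
    assoc  : ∀ i j k l →
               sumFin (suc n) (λ m → N i j m * N m k l)
                 ≡ sumFin (suc n) (λ m → N j k m * N i m l)
    -- involution i* = i:  N_{ij}^0 = δ_{i,j*} = δ_{ij}
    dualN  : ∀ i j → N i j zero ≡ δ i j
    -- N_{ij}^k = N_{jk*}^{i*} = N_{j*i*}^{k*}, with * the identity
    frob₁  : ∀ i j k → N i j k ≡ N j k i
    frob₂  : ∀ i j k → N i j k ≡ N j i k

record Graph (n : ℕ) : Set where
  field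
    adj     : Fin n → Fin n → Bool
    adj-sym : ∀ i j → adj i j ≡ adj j i

_∼[_]_ : {n : ℕ} → Fin n → Graph n → Fin n → Set
i ∼[ G ] j = Graph.adj G i j ≡ true

-- The associated digraph of a fusion ring equals G (viewed as a digraph), with
-- vertex v of G identified with basis index suc v ∈ {1,...,n}:
-- arc (i,j) (loop if i = j) iff N_{ii}^j = 1.
IsAssociatedGraph : {n : ℕ} → SDMFFusionRing n → Graph n → Set
IsAssociatedGraph {n} R G =
  ∀ (i j : Fin n) → (SDMFFusionRing.N R (suc i) (suc i) (suc j) ≡ 1) ⇔ (i ∼[ G ] j)

GeneratesFusionRing : {n : ℕ} → Graph n → Set
GeneratesFusionRing {n} G = ∃[ R ] IsAssociatedGraph {n} R G

EdgeInTriangle : {n : ℕ} → Graph n → Fin n → Fin n → Set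
EdgeInTriangle G i j =
  ∃[ m ] (m ≢ i × m ≢ j × i ≢ j × i ∼[ G ] j × i ∼[ G ] m × j ∼[ G ] m)

-- Write I, J for the basis elements of i, j.  Multiplicity-freeness turns the size of the
-- support of I J into the inner product ⟨I J, I J⟩ = ⟨I², J²⟩ = Σₘ N_{II}^m N_{JJ}^m, whose
-- terms are 1 (at m = 0), N_{II}^I and N_{JJ}^J (at m = I, J) and otherwise count common
-- neighbours of i and j, of which there are none since {i,j} lies in no triangle.  On the other
-- hand I J contains I and J, and since J occurs in I I and K in J J, associativity yields a
-- third constituent of I J.  Hence 3 ≤ 1 + N_{II}^I + N_{JJ}^J, forcing both loops.
module Submission where

open import Defs
open import Data.Nat using (ℕ; zero; suc; _+_; _*_; _≤_; z≤n; s≤s)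
open import Data.Nat.Properties
  using (+-commutativeSemigroup; +-identityʳ; *-zeroʳ; *-identityʳ; *-identityˡ; *-comm; *-distribˡ-+;
         +-mono-≤; m≤m+n; m≤n+m; ≤-refl; ≤-reflexive; ≤-trans; 1+n≰n; module ≤-Reasoning)
open import Data.Fin using (Fin; zero; suc; _≟_)
open import Data.Fin.Properties using (suc-injective)
open import Data.Bool using (false)
open import Data.Product using (_×_; _,_; ∃-syntax)
open import Data.Sum using (_⊎_; inj₁; inj₂)
open import Data.Empty using (⊥-elim)
open import Relation.Binary.PropositionalEquality hiding (J)
open import Relation.Nullary using (¬_; yes; no)
open import Function.Base using (_∘_)
open import Algebra.Properties.CommutativeSemigroup +-commutativeSemigroup
  using () renaming (interchange to +-interchange)
open import Function.Bundles using (Equivalence)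

δ-diag : ∀ {r} (p : Fin r) → δ p p ≡ 1
δ-diag zero    = refl
δ-diag (suc p) = δ-diag p

δ-off : ∀ {r} {p q : Fin r} → p ≢ q → δ p q ≡ 0
δ-off {p = zero}  {zero}  p≢q = ⊥-elim (p≢q refl)
δ-off {p = zero}  {suc q} p≢q = refl
δ-off {p = suc p} {zero}  p≢q = refl
δ-off {p = suc p} {suc q} p≢q = δ-off (λ p≡q → p≢q (cong suc p≡q))

*δ-diag : ∀ {r} c (p : Fin r) → c * δ p p ≡ c
*δ-diag c p = trans (cong (c *_) (δ-diag p)) (*-identityʳ c)

*δ-off : ∀ {r} c {p q : Fin r} → p ≢ q → c * δ p q ≡ 0
*δ-off c p≢q = trans (cong (c *_) (δ-off p≢q)) (*-zeroʳ c)

sumFin-cong : ∀ r {f g : Fin r → ℕ} → (∀ m → f m ≡ g m) → sumFin r f ≡ sumFin r g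
sumFin-cong zero    f≡g = refl
sumFin-cong (suc r) f≡g = cong₂ _+_ (f≡g zero) (sumFin-cong r (λ m → f≡g (suc m)))

sumFin-mono : ∀ r {f g : Fin r → ℕ} → (∀ m → f m ≤ g m) → sumFin r f ≤ sumFin r g
sumFin-mono zero    f≤g = z≤n
sumFin-mono (suc r) f≤g = +-mono-≤ (f≤g zero) (sumFin-mono r (λ m → f≤g (suc m)))

sumFin-+ : ∀ r (f g : Fin r → ℕ) → sumFin r (λ m → f m + g m) ≡ sumFin r f + sumFin r g
sumFin-+ zero    f g = refl
sumFin-+ (suc r) f g =
  trans (cong (f zero + g zero +_) (sumFin-+ r (λ m → f (suc m)) (λ m → g (suc m))))
        (+-interchange (f zero) (g zero) _ _)

sumFin-*ˡ : ∀ r c (f : Fin r → ℕ) → sumFin r (λ m → c * f m) ≡ c * sumFin r f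
sumFin-*ˡ zero    c f = sym (*-zeroʳ c)
sumFin-*ˡ (suc r) c f = trans (cong (c * f zero +_) (sumFin-*ˡ r c (λ m → f (suc m))))
                              (sym (*-distribˡ-+ c (f zero) _))

sumFin-zero : ∀ r → sumFin r (λ _ → 0) ≡ 0
sumFin-zero zero    = refl
sumFin-zero (suc r) = sumFin-zero r

sumFin-δ : ∀ r (p : Fin r) → sumFin r (δ p) ≡ 1
sumFin-δ (suc r) zero    = cong suc (sumFin-zero r)
sumFin-δ (suc r) (suc p) = sumFin-δ r p

sumFin-*δ : ∀ r c (p : Fin r) → sumFin r (λ m → c * δ p m) ≡ c
sumFin-*δ r c p = trans (sumFin-*ˡ r c (δ p)) (trans (cong (c *_) (sumFin-δ r p)) (*-identityʳ c))

sumFin-three-δ : ∀ r x y z (p q s : Fin r) →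
  sumFin r (λ m → x * δ p m + y * δ q m + z * δ s m) ≡ x + y + z
sumFin-three-δ r x y z p q s = begin
  sumFin r (λ m → x * δ p m + y * δ q m + z * δ s m)
    ≡⟨ sumFin-+ r (λ m → x * δ p m + y * δ q m) (λ m → z * δ s m) ⟩
  sumFin r (λ m → x * δ p m + y * δ q m) + sumFin r (λ m → z * δ s m)
    ≡⟨ cong₂ _+_ (sumFin-+ r (λ m → x * δ p m) (λ m → y * δ q m)) (sumFin-*δ r z s) ⟩
  sumFin r (λ m → x * δ p m) + sumFin r (λ m → y * δ q m) + z
    ≡⟨ cong (_+ z) (cong₂ _+_ (sumFin-*δ r x p) (sumFin-*δ r y q)) ⟩
  x + y + z ∎
  where open ≡-Reasoning

sumFin-≥-term : ∀ r (f : Fin r → ℕ) p → f p ≤ sumFin r f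
sumFin-≥-term (suc r) f zero    = m≤m+n (f zero) _
sumFin-≥-term (suc r) f (suc p) = ≤-trans (sumFin-≥-term r (λ m → f (suc m)) p) (m≤n+m _ (f zero))

sumFin-positive-term : ∀ r (f : Fin r → ℕ) → 1 ≤ sumFin r f → ∃[ m ] 1 ≤ f m
sumFin-positive-term (suc r) f 1≤Σ with f zero in f0≡
... | suc _ = zero , subst (1 ≤_) (sym f0≡) (s≤s z≤n)
... | zero with sumFin-positive-term r (λ m → f (suc m)) 1≤Σ
...   | m , 1≤fm = suc m , 1≤fm

sumFin-≥-three : ∀ r (f : Fin r → ℕ) {p q s} → p ≢ q → p ≢ s → q ≢ s →
  f p + f q + f s ≤ sumFin r f
sumFin-≥-three r f {p} {q} {s} p≢q p≢s q≢s = begin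
  f p + f q + f s                                             ≡⟨ sumFin-three-δ r (f p) (f q) (f s) p q s ⟨
  sumFin r (λ m → f p * δ p m + f q * δ q m + f s * δ s m)   ≤⟨ sumFin-mono r pointwise ⟩
  sumFin r f                                                  ∎
  where
  open ≤-Reasoning
  pointwise : ∀ m → f p * δ p m + f q * δ q m + f s * δ s m ≤ f m
  pointwise m with p ≟ m | q ≟ m | s ≟ m
  ... | yes refl | _ | _
    rewrite *δ-diag (f p) p | *δ-off (f q) (p≢q ∘ sym) | *δ-off (f s) (p≢s ∘ sym)
    = ≤-reflexive (trans (+-identityʳ _) (+-identityʳ _))
  ... | no p≢q | yes refl | _
    rewrite *δ-off (f p) p≢q | *δ-diag (f q) q | *δ-off (f s) (q≢s ∘ sym)
    = ≤-reflexive (+-identityʳ _)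
  ... | no p≢s | no q≢s | yes refl
    rewrite *δ-off (f p) p≢s | *δ-off (f q) q≢s | *δ-diag (f s) s = ≤-refl
  ... | no p≢m | no q≢m | no s≢m
    rewrite *δ-off (f p) p≢m | *δ-off (f q) q≢m | *δ-off (f s) s≢m = z≤n

sumFin-≤-three : ∀ r (f : Fin r → ℕ) p q s → (∀ m → m ≢ p → m ≢ q → m ≢ s → f m ≡ 0) →
  sumFin r f ≤ f p + f q + f s
sumFin-≤-three r f p q s outside = begin
  sumFin r f                                                  ≤⟨ sumFin-mono r pointwise ⟩
  sumFin r (λ m → f p * δ p m + f q * δ q m + f s * δ s m)   ≡⟨ sumFin-three-δ r (f p) (f q) (f s) p q s ⟩
  f p + f q + f s                                             ∎
  where
  open ≤-Reasoning
  pointwise : ∀ m → f m ≤ f p * δ p m + f q * δ q m + f s * δ s m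
  pointwise m with p ≟ m | q ≟ m | s ≟ m
  ... | yes refl | _ | _
    rewrite *δ-diag (f p) p = ≤-trans (m≤m+n (f p) _) (m≤m+n _ _)
  ... | no _ | yes refl | _
    rewrite *δ-diag (f q) q = ≤-trans (m≤n+m (f q) (f p * δ p q)) (m≤m+n _ (f s * δ s q))
  ... | no _ | no _ | yes refl
    rewrite *δ-diag (f s) s = m≤n+m (f s) _
  ... | no p≢m | no q≢m | no s≢m
    rewrite outside m (p≢m ∘ sym) (q≢m ∘ sym) (s≢m ∘ sym) = z≤n

≤1⇒≡0⊎≡1 : ∀ {x} → x ≤ 1 → x ≡ 0 ⊎ x ≡ 1
≤1⇒≡0⊎≡1 z≤n       = inj₁ refl
≤1⇒≡0⊎≡1 (s≤s z≤n) = inj₂ refl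

≤1∧≤1∧3≤1+x+y⇒≡1 : ∀ {x y} → x ≤ 1 → y ≤ 1 → 3 ≤ 1 + x + y → x ≡ 1 × y ≡ 1
≤1∧≤1∧3≤1+x+y⇒≡1 (s≤s z≤n) (s≤s z≤n) _                 = refl , refl
≤1∧≤1∧3≤1+x+y⇒≡1 z≤n       z≤n       (s≤s ())
≤1∧≤1∧3≤1+x+y⇒≡1 z≤n       (s≤s z≤n) (s≤s (s≤s ()))
≤1∧≤1∧3≤1+x+y⇒≡1 (s≤s z≤n) z≤n       (s≤s (s≤s ()))

module FusionRingProperties {n : ℕ} (R : SDMFFusionRing n) where
  open SDMFFusionRing R

  N-sym₂₃ : ∀ a b c → N a b c ≡ N a c b
  N-sym₂₃ a b c = trans (sym (frob₁ c a b)) (comm c a b)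

  N-sym₁₃ : ∀ a b c → N a b c ≡ N c b a
  N-sym₁₃ a b c = trans (frob₁ a b c) (comm b c a)

  N-unit-diag : ∀ a → N a a zero ≡ 1
  N-unit-diag a = trans (dualN a a) (δ-diag a)

  N-unit-off : ∀ {a b} → a ≢ b → N a b zero ≡ 0
  N-unit-off a≢b = trans (dualN _ _) (δ-off a≢b)

  N-idem : ∀ a b c → N a b c * N a b c ≡ N a b c
  N-idem a b c with ≤1⇒≡0⊎≡1 (N-le1 a b c)
  ... | inj₁ N≡0 rewrite N≡0 = refl
  ... | inj₂ N≡1 rewrite N≡1 = refl

  N*N≥1⇒≡1 : ∀ {a b c a′ b′ c′} → 1 ≤ N a b c * N a′ b′ c′ → N a b c ≡ 1 × N a′ b′ c′ ≡ 1
  N*N≥1⇒≡1 {a} {b} {c} {a′} {b′} {c′} 1≤NN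
    with ≤1⇒≡0⊎≡1 (N-le1 a b c) | ≤1⇒≡0⊎≡1 (N-le1 a′ b′ c′)
  ... | inj₂ N≡1 | inj₂ N′≡1 = N≡1 , N′≡1
  ... | inj₁ N≡0 | _         rewrite N≡0 = ⊥-elim (1+n≰n 1≤NN)
  ... | inj₂ N≡1 | inj₁ N′≡0 rewrite N≡1 | N′≡0 = ⊥-elim (1+n≰n 1≤NN)

  -- e occurs in (X_a X_b) X_d = X_a (X_b X_d), hence in X_a X_m for a constituent m of X_b X_d.
  constituent-reassoc : ∀ {a b c d e} → N a b c ≡ 1 → N c d e ≡ 1 →
    ∃[ m ] N b d m ≡ 1 × N a m e ≡ 1
  constituent-reassoc {a} {b} {c} {d} {e} Nabc≡1 Ncde≡1
    with sumFin-positive-term (suc n) (λ m → N b d m * N a m e) 1≤Σ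
    where
    1≤Σ : 1 ≤ sumFin (suc n) (λ m → N b d m * N a m e)
    1≤Σ = begin
      1                                            ≡⟨ cong₂ _*_ Nabc≡1 Ncde≡1 ⟨
      N a b c * N c d e                            ≤⟨ sumFin-≥-term (suc n) (λ m → N a b m * N m d e) c ⟩
      sumFin (suc n) (λ m → N a b m * N m d e)    ≡⟨ assoc a b d e ⟩
      sumFin (suc n) (λ m → N b d m * N a m e)    ∎
      where open ≤-Reasoning
  ... | m , 1≤NN = m , N*N≥1⇒≡1 1≤NN

  -- Multiplicity-freeness makes Σₘ N_{ab}^m the norm ⟨X_a X_b, X_a X_b⟩, which
  -- associativity and Frobenius reciprocity turn into ⟨X_a X_a, X_b X_b⟩.
  sumFin-N≡⟨aa,bb⟩ : ∀ a b → sumFin (suc n) (N a b) ≡ sumFin (suc n) (λ m → N a a m * N b b m)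
  sumFin-N≡⟨aa,bb⟩ a b = begin
    sumFin (suc n) (N a b)                          ≡⟨ sumFin-cong (suc n) (λ m → sym (N-idem a b m)) ⟩
    sumFin (suc n) (λ m → N a b m * N a b m)        ≡⟨ sumFin-cong (suc n) (λ m → cong (N a b m *_) (N-sym₁₃ a b m)) ⟩
    sumFin (suc n) (λ m → N a b m * N m b a)        ≡⟨ assoc a b b a ⟩
    sumFin (suc n) (λ m → N b b m * N a m a)        ≡⟨ sumFin-cong (suc n) (λ m → trans (*-comm (N b b m) (N a m a)) (cong (_* N b b m) (N-sym₂₃ a m a))) ⟩
    sumFin (suc n) (λ m → N a a m * N b b m)        ∎
    where open ≡-Reasoning

module InducedPath {n : ℕ} (G : Graph n) (R : SDMFFusionRing n) (R-gen : IsAssociatedGraph R G)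
  {i j k : Fin n} (i≢j : i ≢ j) (j≢k : j ≢ k) (i≢k : i ≢ k)
  (i∼j : i ∼[ G ] j) (j∼k : j ∼[ G ] k) (i≁k : Graph.adj G i k ≡ false)
  (no-triangle : ¬ EdgeInTriangle G i j) where
  open SDMFFusionRing R
  open FusionRingProperties R

  I J K : Fin (suc n)
  I = suc i
  J = suc j
  K = suc k

  ∼⇒N≡1 : ∀ {a b} → a ∼[ G ] b → N (suc a) (suc a) (suc b) ≡ 1
  ∼⇒N≡1 {a} {b} = Equivalence.from (R-gen a b)

  N≡1⇒∼ : ∀ {a b} → N (suc a) (suc a) (suc b) ≡ 1 → a ∼[ G ] b
  N≡1⇒∼ {a} {b} = Equivalence.to (R-gen a b)

  ∼-sym : ∀ {a b} → a ∼[ G ] b → b ∼[ G ] a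
  ∼-sym {a} {b} a∼b = trans (Graph.adj-sym G b a) a∼b

  ¬i∼k : ¬ i ∼[ G ] k
  ¬i∼k i∼k with trans (sym i∼k) i≁k
  ... | ()

  Nᵢⱼⁱ≡1 : N I J I ≡ 1
  Nᵢⱼⁱ≡1 = trans (N-sym₂₃ I J I) (∼⇒N≡1 i∼j)

  Nᵢⱼʲ≡1 : N I J J ≡ 1
  Nᵢⱼʲ≡1 = trans (N-sym₁₃ I J J) (∼⇒N≡1 (∼-sym i∼j))

  -- Reassociating I I ∋ J and J J ∋ K gives a constituent m of I J with K in I m;
  -- m = 0, I, K are excluded by i ≢ j and i ≁ k, and m = J makes K itself the third one.
  third-constituent : ∃[ t ] t ≢ i × t ≢ j × N I J (suc t) ≡ 1
  third-constituent with constituent-reassoc (∼⇒N≡1 i∼j) (∼⇒N≡1 j∼k)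
  ... | zero , Nᵢⱼ⁰≡1 , _ with trans (sym (N-unit-off (i≢j ∘ suc-injective))) Nᵢⱼ⁰≡1
  ...   | ()
  third-constituent | suc t , Nᵢⱼᵗ≡1 , Nᵢₜᵏ≡1 with t ≟ i | t ≟ j | t ≟ k
  ... | yes refl | _ | _ = ⊥-elim (¬i∼k (N≡1⇒∼ Nᵢₜᵏ≡1))
  ... | no _ | yes refl | _ = k , (i≢k ∘ sym) , (j≢k ∘ sym) , Nᵢₜᵏ≡1
  ... | no _ | no _ | yes refl =
    ⊥-elim (¬i∼k (∼-sym (N≡1⇒∼ (trans (sym (N-sym₁₃ I K K)) Nᵢₜᵏ≡1))))
  ... | no t≢i | no t≢j | no _ = t , t≢i , t≢j , Nᵢⱼᵗ≡1

  common-neighbour-free : ∀ {u} → u ≢ i → u ≢ j → N I I (suc u) * N J J (suc u) ≡ 0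
  common-neighbour-free {u} u≢i u≢j
    with ≤1⇒≡0⊎≡1 (N-le1 I I (suc u)) | ≤1⇒≡0⊎≡1 (N-le1 J J (suc u))
  ... | inj₁ N≡0 | _ rewrite N≡0 = refl
  ... | inj₂ _ | inj₁ N≡0 rewrite N≡0 = *-zeroʳ (N I I (suc u))
  ... | inj₂ Nᵢᵢᵘ≡1 | inj₂ Nⱼⱼᵘ≡1 =
    ⊥-elim (no-triangle (u , u≢i , u≢j , i≢j , i∼j , N≡1⇒∼ Nᵢᵢᵘ≡1 , N≡1⇒∼ Nⱼⱼᵘ≡1))

  3≤support : 3 ≤ sumFin (suc n) (N I J)
  3≤support with third-constituent
  ... | t , t≢i , t≢j , Nᵢⱼᵗ≡1 = begin
    1 + 1 + 1                            ≡⟨ cong₂ _+_ (cong₂ _+_ Nᵢⱼⁱ≡1 Nᵢⱼʲ≡1) Nᵢⱼᵗ≡1 ⟨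
    N I J I + N I J J + N I J (suc t)    ≤⟨ sumFin-≥-three (suc n) (N I J) I≢J I≢T J≢T ⟩
    sumFin (suc n) (N I J)               ∎
    where
    open ≤-Reasoning
    I≢J : I ≢ J
    I≢J = i≢j ∘ suc-injective
    I≢T : I ≢ suc t
    I≢T = t≢i ∘ sym ∘ suc-injective
    J≢T : J ≢ suc t
    J≢T = t≢j ∘ sym ∘ suc-injective

  support≤1+loops : sumFin (suc n) (N I J) ≤ 1 + N I I I + N J J J
  support≤1+loops = begin
    sumFin (suc n) (N I J)                      ≡⟨ sumFin-N≡⟨aa,bb⟩ I J ⟩
    sumFin (suc n) (λ m → N I I m * N J J m)    ≤⟨ sumFin-≤-three (suc n) _ zero I J outside ⟩
    N I I zero * N J J zero + N I I I * N J J I + N I I J * N J J J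
      ≡⟨ cong₂ _+_ (cong₂ _+_ (cong₂ _*_ (N-unit-diag I) (N-unit-diag J)) (cong (N I I I *_) (∼⇒N≡1 (∼-sym i∼j))))
                   (cong (_* N J J J) (∼⇒N≡1 i∼j)) ⟩
    1 * 1 + N I I I * 1 + 1 * N J J J           ≡⟨ cong₂ _+_ (cong (1 +_) (*-identityʳ (N I I I))) (*-identityˡ (N J J J)) ⟩
    1 + N I I I + N J J J                       ∎
    where
    open ≤-Reasoning
    outside : ∀ m → m ≢ zero → m ≢ I → m ≢ J → N I I m * N J J m ≡ 0
    outside zero    m≢0 _   _   = ⊥-elim (m≢0 refl)
    outside (suc u) _   u≢I u≢J = common-neighbour-free (u≢I ∘ cong suc) (u≢J ∘ cong suc)

  loops : i ∼[ G ] i × j ∼[ G ] j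
  loops with ≤1∧≤1∧3≤1+x+y⇒≡1 (N-le1 I I I) (N-le1 J J J) (≤-trans 3≤support support≤1+loops)
  ... | Nᵢᵢⁱ≡1 , Nⱼⱼʲ≡1 = N≡1⇒∼ Nᵢᵢⁱ≡1 , N≡1⇒∼ Nⱼⱼʲ≡1

mainTheorem11 : {n : ℕ} (G : Graph n) → GeneratesFusionRing G →
    (i j k : Fin n) → i ≢ j → j ≢ k → i ≢ k →
    i ∼[ G ] j → j ∼[ G ] k → Graph.adj G i k ≡ false →
    ¬ EdgeInTriangle G i j →
    (i ∼[ G ] i) × (j ∼[ G ] j)
mainTheorem11 G (R , R-gen) i j k i≢j j≢k i≢k i∼j j∼k i≁k no-triangle =
  InducedPath.loops G R R-gen i≢j j≢k i≢k i∼j j∼k i≁k no-triangle
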